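{- Every 2-DORG is a Stick graph.
   Context: A 2-DORG (two-directional orthogonal ray graph) is the bipartite intersection graph of a finite family of axis-parallel rays in the plane, each pointing either upward or leftward (two orthogonal directions), where start points have pairwise distinct x- and y-coordinates so that parallel rays are disjoint; vertices are rays, and an upward and a leftward ray are adjacent iff they intersect. A Stick graph is the intersection graph of a finite family of horizontal and vertical segments (no two parallel ones intersecting) such that there is a line $\ell$ of positive slope containing the left endpoint of every horizontal segment and the top endpoint of every vertical segment.
   Formalization: Ray start points have rational coordinates, and the segments and the line ℓ of the Stick representation are taken over ℚ as well. -}

module Defs where

open import Data.Nat using (ℕ)
open import Data.Fin using (Fin)
open import Data.Rational using (ℚ; _≤_; _<_; _+_; _*_; 0ℚ)
open import Data.Product using (_×_; _,_; ∃; ∃-syntax)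
open import Relation.Binary.PropositionalEquality using (_≡_; _≢_)
open import Relation.Nullary using (¬_)
open import Function.Bundles using (_⇔_)

Point : Set
Point = ℚ × ℚ

record Graph : Set₁ where
  field
    n   : ℕ
    Adj : Fin n → Fin n → Set
open Graph public

Meets : {A : Set} → (A → Point → Set) → A → A → Set
Meets on a b = ∃[ p ] (on a p × on b p)

IsIntersectionRep : {A : Set} → (A → Point → Set) → (G : Graph) → (Fin (n G) → A) → Set
IsIntersectionRep on G f =
  ∀ i j → Adj G i j ⇔ (i ≢ j × Meets on (f i) (f j))

data RayDir : Set where
  upward leftward : RayDir

record Ray : Set where
  constructor ray
  field
    dir : RayDir
    sx  : ℚ
    sy  : ℚ
open Ray public

OnRay : Ray → Point → Set
OnRay (ray upward   x y) (px , py) = (px ≡ x) × (y ≤ py)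
OnRay (ray leftward x y) (px , py) = (py ≡ y) × (px ≤ x)

Is2DORG : Graph → Set
Is2DORG G =
  ∃[ f ] ( (∀ i j → i ≢ j → sx (f i) ≢ sx (f j))
         × (∀ i j → i ≢ j → sy (f i) ≢ sy (f j))
         × IsIntersectionRep OnRay G f )

data SegDir : Set where
  horizontal vertical : SegDir

-- horizontal: {(t , c) | lo ≤ t ≤ hi};  vertical: {(c , t) | lo ≤ t ≤ hi}
record Segment : Set where
  constructor seg
  field
    sdir : SegDir
    c    : ℚ
    lo   : ℚ
    hi   : ℚ
open Segment public

OnSeg : Segment → Point → Set
OnSeg (seg horizontal c lo hi) (px , py) = (py ≡ c) × (lo ≤ px) × (px ≤ hi)
OnSeg (seg vertical   c lo hi) (px , py) = (px ≡ c) × (lo ≤ py) × (py ≤ hi)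

anchor : Segment → Point
anchor (seg horizontal c lo hi) = (lo , c)
anchor (seg vertical   c lo hi) = (c , hi)

OnLine : ℚ → ℚ → Point → Set
OnLine m q (px , py) = py ≡ m * px + q

IsStickGraph : Graph → Set
IsStickGraph G =
  ∃[ f ] ( (∀ i → lo (f i) ≤ hi (f i))
         × (∀ i j → i ≢ j → sdir (f i) ≡ sdir (f j) → ¬ Meets OnSeg (f i) (f j))
         × (∃[ m ] ∃[ q ] (0ℚ < m × (∀ i → OnLine m q (anchor (f i)))))
         × IsIntersectionRep OnSeg G f )

-- Cut every ray where it crosses the line y = x + q: an upward ray from (x, y)
-- becomes the vertical stick from (x, y) up to (x, x + q), a leftward ray from
-- (x, y) the horizontal stick from (y - q, y) to (x, y). The sticks are subsets
-- of the rays, so parallel ones stay disjoint and no new intersections appear.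
-- An upward ray at x and a leftward ray at height y' can only cross at (x, y'),
-- which survives the cut as soon as y' ≤ x + q; taking q at least the largest
-- y-coordinate minus the smallest x-coordinate of a start point keeps them all.
module Submission where

open import Defs
open import Data.Nat using (zero; suc)
open import Data.Fin using (Fin; zero; suc)
open import Data.Rational using (ℚ; _≤_; _+_; _-_; -_; 0ℚ; 1ℚ; _⊔_)
open import Data.Rational.Properties
  using (≤-trans; +-mono-≤; +-monoˡ-≤; +-monoʳ-≤; +-0-group; *-identityˡ; p≤p⊔q; p≤q⊔p; positive⁻¹)
open import Algebra.Properties.Group +-0-group using (\\-leftDividesˡ; //-rightDividesˡ; //-rightDividesʳ)
open import Data.Product using (_,_; ∃-syntax)
open import Relation.Binary.PropositionalEquality using (_≡_; _≢_; refl; sym; trans; cong; subst)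
open import Relation.Nullary using (¬_)
open import Data.Empty using (⊥-elim)
open import Function.Base using (_∘′_)
open import Function.Bundles using (_⇔_; mk⇔; Equivalence)

finite-boundedAbove : ∀ {n} (f : Fin n → ℚ) → ∃[ b ] (∀ i → f i ≤ b)
finite-boundedAbove {zero}  f = 0ℚ , λ ()
finite-boundedAbove {suc n} f with finite-boundedAbove (λ i → f (suc i))
... | b , f≤b = f zero ⊔ b , λ
  { zero    → p≤p⊔q (f zero) b
  ; (suc i) → ≤-trans (f≤b i) (p≤q⊔p (f zero) b)
  }

finite-boundedOffset : ∀ {n} (f g : Fin n → ℚ) → ∃[ q ] (∀ i j → f i ≤ g j + q)
finite-boundedOffset f g with finite-boundedAbove f | finite-boundedAbove (λ j → - g j)
... | u , f≤u | v , -g≤v = v + u , λ i j →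
  subst (_≤ g j + (v + u)) (\\-leftDividesˡ (g j) (f i))
        (+-monoʳ-≤ (g j) (+-mono-≤ (-g≤v j) (f≤u i)))

p≤q+r⇒p-r≤q : ∀ {p q} r → p ≤ q + r → p - r ≤ q
p≤q+r⇒p-r≤q {q = q} r p≤q+r = subst (_ ≤_) (//-rightDividesʳ r q) (+-monoˡ-≤ (- r) p≤q+r)

Meets-sym : ∀ {A} (on : A → Point → Set) a b → Meets on a b → Meets on b a
Meets-sym on a b (p , a∋p , b∋p) = p , b∋p , a∋p

IsIntersectionRep-transfer : ∀ {A B} (on : A → Point → Set) (on′ : B → Point → Set) G
  (f : Fin (n G) → A) (g : Fin (n G) → B) →
  (∀ i j → i ≢ j → Meets on (f i) (f j) ⇔ Meets on′ (g i) (g j)) →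
  IsIntersectionRep on G f → IsIntersectionRep on′ G g
IsIntersectionRep-transfer on on′ G f g f≈g rep i j = mk⇔
  (λ adj → let (i≢j , m) = Equivalence.to (rep i j) adj in i≢j , Equivalence.to (f≈g i j i≢j) m)
  (λ { (i≢j , m) → Equivalence.from (rep i j) (i≢j , Equivalence.from (f≈g i j i≢j) m) })

parallel-rays-disjoint : ∀ r s → dir r ≡ dir s → sx r ≢ sx s → sy r ≢ sy s → ¬ Meets OnRay r s
parallel-rays-disjoint (ray upward _ _)   (ray upward _ _)   _ x≢x′ _ (_ , (refl , _) , (x≡x′ , _)) = x≢x′ x≡x′
parallel-rays-disjoint (ray leftward _ _) (ray leftward _ _) _ _ y≢y′ (_ , (refl , _) , (y≡y′ , _)) = y≢y′ y≡y′

truncate : ℚ → Ray → Segment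
truncate q (ray upward   x y) = seg vertical   x y (x + q)
truncate q (ray leftward x y) = seg horizontal y (y - q) x

truncate-⊆ : ∀ q r {p} → OnSeg (truncate q r) p → OnRay r p
truncate-⊆ q (ray upward   x y) (px≡x , y≤py , _) = px≡x , y≤py
truncate-⊆ q (ray leftward x y) (py≡y , _ , px≤x) = py≡y , px≤x

truncate-reflects-Meets : ∀ q r s → Meets OnSeg (truncate q r) (truncate q s) → Meets OnRay r s
truncate-reflects-Meets q r s (p , r∋p , s∋p) = p , truncate-⊆ q r r∋p , truncate-⊆ q s s∋p

truncate-sdir-injective : ∀ q r s → sdir (truncate q r) ≡ sdir (truncate q s) → dir r ≡ dir s
truncate-sdir-injective q (ray upward   _ _) (ray upward   _ _) _ = refl
truncate-sdir-injective q (ray leftward _ _) (ray leftward _ _) _ = refl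

truncate-lo≤hi : ∀ q r → sy r ≤ sx r + q → lo (truncate q r) ≤ hi (truncate q r)
truncate-lo≤hi q (ray upward   x y) y≤x+q = y≤x+q
truncate-lo≤hi q (ray leftward x y) y≤x+q = p≤q+r⇒p-r≤q q y≤x+q

truncate-anchor : ∀ q r → OnLine 1ℚ q (anchor (truncate q r))
truncate-anchor q (ray upward   x y) = cong (_+ q) (sym (*-identityˡ x))
truncate-anchor q (ray leftward x y) =
  trans (sym (//-rightDividesˡ q y)) (cong (_+ q) (sym (*-identityˡ (y - q))))

truncate-keeps-crossing : ∀ q x y x′ y′ → y′ ≤ x + q →
  Meets OnRay (ray upward x y) (ray leftward x′ y′) →
  Meets OnSeg (truncate q (ray upward x y)) (truncate q (ray leftward x′ y′))
truncate-keeps-crossing q x y x′ y′ y′≤x+q (_ , (refl , y≤y′) , (refl , x≤x′)) =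
  _ , (refl , y≤y′ , y′≤x+q) , (refl , p≤q+r⇒p-r≤q q y′≤x+q , x≤x′)

truncate-keeps-Meets : ∀ q r s → sx r ≢ sx s → sy r ≢ sy s →
  sy s ≤ sx r + q → sy r ≤ sx s + q →
  Meets OnRay r s → Meets OnSeg (truncate q r) (truncate q s)
truncate-keeps-Meets q r@(ray upward _ _) s@(ray upward _ _) x≢x′ y≢y′ _ _ m =
  ⊥-elim (parallel-rays-disjoint r s refl x≢x′ y≢y′ m)
truncate-keeps-Meets q (ray upward x y) (ray leftward x′ y′) _ _ y′≤x+q _ =
  truncate-keeps-crossing q x y x′ y′ y′≤x+q
truncate-keeps-Meets q r@(ray leftward x y) s@(ray upward x′ y′) _ _ _ y≤x′+q m =
  Meets-sym OnSeg (truncate q s) (truncate q r)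
    (truncate-keeps-crossing q x′ y′ x y y≤x′+q (Meets-sym OnRay r s m))
truncate-keeps-Meets q r@(ray leftward _ _) s@(ray leftward _ _) x≢x′ y≢y′ _ _ m =
  ⊥-elim (parallel-rays-disjoint r s refl x≢x′ y≢y′ m)

proposition3 : (G : Graph) → Is2DORG G → IsStickGraph G
proposition3 G (f , sx≢ , sy≢ , rep) with finite-boundedOffset (λ i → sy (f i)) (λ i → sx (f i))
... | q , window =
  stick ,
  (λ i → truncate-lo≤hi q (f i) (window i i)) ,
  (λ i j i≢j same → parallel-rays-disjoint (f i) (f j)
                      (truncate-sdir-injective q (f i) (f j) same) (sx≢ i j i≢j) (sy≢ i j i≢j)
                    ∘′ truncate-reflects-Meets q (f i) (f j)) ,
  (1ℚ , q , positive⁻¹ 1ℚ , λ i → truncate-anchor q (f i)) ,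
  IsIntersectionRep-transfer OnRay OnSeg G f stick rays⇔sticks rep
  where
  stick : Fin (n G) → Segment
  stick i = truncate q (f i)

  rays⇔sticks : ∀ i j → i ≢ j → Meets OnRay (f i) (f j) ⇔ Meets OnSeg (stick i) (stick j)
  rays⇔sticks i j i≢j = mk⇔
    (truncate-keeps-Meets q (f i) (f j) (sx≢ i j i≢j) (sy≢ i j i≢j) (window j i) (window i j))
    (truncate-reflects-Meets q (f i) (f j))
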